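{- Let $u,v\ge 1$ be integers and let $z$ be an indeterminate. Every vertex of the tree $\mathcal{T}^{(u,v)}(z)$ can be written, as an element of the field $\mathbb{Q}(z)$, in the form $\dfrac{az+b}{cz+d}$ for some nonnegative integers $a,b,c,d$ with $ad-bc=1$.
   Context: For integers $u,v\ge 1$ and an indeterminate $z$, the $(u,v)$-Calkin–Wilf tree $\mathcal{T}^{(u,v)}(z)$ is the infinite binary tree with root $z$, whose vertices are elements of $\mathbb{Q}(z)$, in which every vertex $w$ has left child $w/(uw+1)$ and right child $w+v$. -}

module Defs where

open import Data.Nat using (ℕ; zero; suc)
open import Data.Integer using (ℤ; +_; 0ℤ; 1ℤ) renaming (_+_ to _+ℤ_; _*_ to _*ℤ_)
open import Data.List using (List; []; _∷_)
open import Data.Product using (∃; _×_)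
open import Relation.Binary.PropositionalEquality using (_≡_; _≢_)

-- Polynomials ℤ[z], as coefficient lists (constant term first).

Poly : Set
Poly = List ℤ

coeff : Poly → ℕ → ℤ
coeff []       _       = 0ℤ
coeff (a ∷ p)  zero    = a
coeff (a ∷ p)  (suc i) = coeff p i

_≈ₚ_ : Poly → Poly → Set
p ≈ₚ q = ∀ i → coeff p i ≡ coeff q i

NonZeroₚ : Poly → Set
NonZeroₚ p = ∃ λ i → coeff p i ≢ 0ℤ

_+ₚ_ : Poly → Poly → Poly
[]      +ₚ q       = q
(a ∷ p) +ₚ []      = a ∷ p
(a ∷ p) +ₚ (b ∷ q) = (a +ℤ b) ∷ (p +ₚ q)

scaleₚ : ℤ → Poly → Poly
scaleₚ c []      = []
scaleₚ c (a ∷ p) = (c *ℤ a) ∷ scaleₚ c p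

_*ₚ_ : Poly → Poly → Poly
[]      *ₚ q = []
(a ∷ p) *ₚ q = scaleₚ a q +ₚ (0ℤ ∷ (p *ₚ q))

constₚ : ℤ → Poly
constₚ c = c ∷ []

Xₚ : Poly
Xₚ = 0ℤ ∷ 1ℤ ∷ []

-- The field ℚ(z) = Frac(ℤ[z]), elements represented as fractions
-- num / den (den intended nonzero), with the usual fraction equality.

record RatFun : Set where
  constructor _//_
  field
    num : Poly
    den : Poly
open RatFun public

_≈_ : RatFun → RatFun → Set
f ≈ g = (num f *ₚ den g) ≈ₚ (num g *ₚ den f)

_⊕_ : RatFun → RatFun → RatFun
(p // q) ⊕ (r // s) = ((p *ₚ s) +ₚ (r *ₚ q)) // (q *ₚ s)

_⊗_ : RatFun → RatFun → RatFun
(p // q) ⊗ (r // s) = (p *ₚ r) // (q *ₚ s)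

-- division (used only with a nonzero divisor)
_⊘_ : RatFun → RatFun → RatFun
(p // q) ⊘ (r // s) = (p *ₚ s) // (q *ₚ r)

ι : ℤ → RatFun
ι c = constₚ c // constₚ 1ℤ

𝕫 : RatFun
𝕫 = Xₚ // constₚ 1ℤ

data IsVertex (u v : ℕ) : RatFun → Set where
  root  : IsVertex u v 𝕫
  left  : ∀ {w} → IsVertex u v w → IsVertex u v (w ⊘ ((ι (+ u) ⊗ w) ⊕ ι 1ℤ))
  right : ∀ {w} → IsVertex u v w → IsVertex u v (w ⊕ ι (+ v))

möb : ℕ → ℕ → ℕ → ℕ → RatFun
möb a b c d = ((ι (+ a) ⊗ 𝕫) ⊕ ι (+ b)) ⊘ ((ι (+ c) ⊗ 𝕫) ⊕ ι (+ d))

{-# OPTIONS --safe #-}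
-- The root is
-- (1·z + 0)/(0·z + 1); the right child adds v times the bottom row (c, d) of the
-- matrix [[a, b], [c, d]] to its top row, and the left child adds u times the top
-- row to the bottom row. Both moves keep the entries nonnegative and the
-- determinant equal to 1. The fraction operations never cancel common factors, so the
-- representative of a vertex is k(az + b)/k(cz + d) for a polynomial k that grows
-- along the path; k(1) ≠ 0 shows that the denominator is not the zero polynomial.
module Submission where

open import Defs
open import Data.Nat using (ℕ; zero; suc; _≤_; _*_; _+_)
open import Data.Product using (Σ; ∃; _×_; _,_)
open import Relation.Binary.PropositionalEquality using (_≡_)

open import Algebra.Bundles using (CommutativeMonoid; CommutativeSemiring)
open import Algebra.Structures.Biased using (isCommutativeMonoidˡ; isCommutativeSemiringˡ)
import Algebra.Properties.CommutativeSemigroup as CommutativeSemigroupProperties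
open import Data.Empty using (⊥-elim)
open import Data.Integer using (ℤ; +_; 0ℤ; 1ℤ) renaming (_+_ to _+ℤ_; _*_ to _*ℤ_)
import Data.Integer.Properties as ℤ
import Data.Integer.Tactic.RingSolver as ℤ-Solver
open import Data.List using ([]; _∷_)
open import Data.Maybe using (nothing)
import Data.Nat.Properties as ℕ
import Data.Nat.Tactic.RingSolver as ℕ-Solver
open import Data.Sum using ([_,_]′)
open import Level using (0ℓ)
open import Relation.Binary.Bundles using (Setoid)
open import Relation.Binary.Structures using (IsEquivalence)
open import Relation.Binary.PropositionalEquality using (_≢_; refl; sym; trans; cong; cong₂; module ≡-Reasoning)
import Relation.Binary.Reasoning.Setoid as SetoidReasoning
open import Relation.Nullary using (yes; no)
open import Tactic.RingSolver using (solve-∀)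
open import Tactic.RingSolver.Core.AlmostCommutativeRing using (AlmostCommutativeRing; fromCommutativeSemiring)

-- ℤ[z] as a commutative semiring up to coefficientwise equality

-- A record wrapper around _≈ₚ_, so that both polynomials can be inferred.
infix 4 _≋_
record _≋_ (p q : Poly) : Set where
  constructor coeffwise
  field coeff-≡ : p ≈ₚ q
open _≋_

≋-isEquivalence : IsEquivalence _≋_
≋-isEquivalence = record
  { refl  = coeffwise λ _ → refl
  ; sym   = λ e → coeffwise λ i → sym (coeff-≡ e i)
  ; trans = λ e f → coeffwise λ i → trans (coeff-≡ e i) (coeff-≡ f i)
  }

≋-setoid : Setoid 0ℓ 0ℓ
≋-setoid = record { isEquivalence = ≋-isEquivalence }

open IsEquivalence ≋-isEquivalence
  renaming (refl to ≋-refl; sym to ≋-sym; trans to ≋-trans)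
module ≋-Reasoning = SetoidReasoning ≋-setoid

coeff-+ₚ : ∀ p q i → coeff (p +ₚ q) i ≡ coeff p i +ℤ coeff q i
coeff-+ₚ []      q       i       = sym (ℤ.+-identityˡ _)
coeff-+ₚ (a ∷ p) []      i       = sym (ℤ.+-identityʳ _)
coeff-+ₚ (a ∷ p) (b ∷ q) zero    = refl
coeff-+ₚ (a ∷ p) (b ∷ q) (suc i) = coeff-+ₚ p q i

coeff-scaleₚ : ∀ c p i → coeff (scaleₚ c p) i ≡ c *ℤ coeff p i
coeff-scaleₚ c []      i       = sym (ℤ.*-zeroʳ c)
coeff-scaleₚ c (a ∷ p) zero    = refl
coeff-scaleₚ c (a ∷ p) (suc i) = coeff-scaleₚ c p i

∷-cong : ∀ {a b p q} → a ≡ b → p ≋ q → a ∷ p ≋ b ∷ q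
∷-cong a≡b e = coeffwise λ where
  zero    → a≡b
  (suc i) → coeff-≡ e i

+ₚ-cong : ∀ {p p′ q q′} → p ≋ p′ → q ≋ q′ → p +ₚ q ≋ p′ +ₚ q′
+ₚ-cong {p} {p′} {q} {q′} e f = coeffwise λ i → trans (coeff-+ₚ p q i)
  (trans (cong₂ _+ℤ_ (coeff-≡ e i) (coeff-≡ f i)) (sym (coeff-+ₚ p′ q′ i)))

+ₚ-comm : ∀ p q → p +ₚ q ≋ q +ₚ p
+ₚ-comm p q = coeffwise λ i → trans (coeff-+ₚ p q i)
  (trans (ℤ.+-comm (coeff p i) (coeff q i)) (sym (coeff-+ₚ q p i)))

+ₚ-assoc : ∀ p q r → (p +ₚ q) +ₚ r ≋ p +ₚ (q +ₚ r)
+ₚ-assoc p q r = coeffwise λ i → trans (coeff-+ₚ (p +ₚ q) r i)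
  (trans (cong (_+ℤ coeff r i) (coeff-+ₚ p q i))
  (trans (ℤ.+-assoc (coeff p i) (coeff q i) (coeff r i))
  (trans (cong (λ x → coeff p i +ℤ x) (sym (coeff-+ₚ q r i))) (sym (coeff-+ₚ p (q +ₚ r) i)))))

+ₚ-commutativeMonoid : CommutativeMonoid 0ℓ 0ℓ
+ₚ-commutativeMonoid = record
  { _≈_ = _≋_
  ; _∙_ = _+ₚ_
  ; ε   = []
  ; isCommutativeMonoid = isCommutativeMonoidˡ record
    { isSemigroup = record
      { isMagma = record { isEquivalence = ≋-isEquivalence ; ∙-cong = +ₚ-cong }
      ; assoc   = +ₚ-assoc
      }
    ; identityˡ = λ _ → ≋-refl
    ; comm      = +ₚ-comm
    }
  }

open CommutativeMonoid +ₚ-commutativeMonoid using () renaming (identityʳ to +ₚ-identityʳ)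
open CommutativeSemigroupProperties (CommutativeMonoid.commutativeSemigroup +ₚ-commutativeMonoid)
  using (interchange; x∙yz≈y∙xz)

[0]≋[] : 0ℤ ∷ [] ≋ []
[0]≋[] = coeffwise λ where
  zero    → refl
  (suc i) → refl

scaleₚ-cong : ∀ c {p q} → p ≋ q → scaleₚ c p ≋ scaleₚ c q
scaleₚ-cong c {p} {q} e = coeffwise λ i →
  trans (coeff-scaleₚ c p i) (trans (cong (c *ℤ_) (coeff-≡ e i)) (sym (coeff-scaleₚ c q i)))

scaleₚ-distribˡ : ∀ c p q → scaleₚ c (p +ₚ q) ≋ scaleₚ c p +ₚ scaleₚ c q
scaleₚ-distribˡ c p q = coeffwise λ i → trans (coeff-scaleₚ c (p +ₚ q) i)
  (trans (cong (c *ℤ_) (coeff-+ₚ p q i)) (trans (ℤ.*-distribˡ-+ c (coeff p i) (coeff q i))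
  (sym (trans (coeff-+ₚ (scaleₚ c p) (scaleₚ c q) i) (cong₂ _+ℤ_ (coeff-scaleₚ c p i) (coeff-scaleₚ c q i))))))

scaleₚ-distribʳ : ∀ a b p → scaleₚ (a +ℤ b) p ≋ scaleₚ a p +ₚ scaleₚ b p
scaleₚ-distribʳ a b p = coeffwise λ i → trans (coeff-scaleₚ (a +ℤ b) p i)
  (trans (ℤ.*-distribʳ-+ (coeff p i) a b)
  (sym (trans (coeff-+ₚ (scaleₚ a p) (scaleₚ b p) i) (cong₂ _+ℤ_ (coeff-scaleₚ a p i) (coeff-scaleₚ b p i)))))

scaleₚ-assoc : ∀ a b p → scaleₚ a (scaleₚ b p) ≋ scaleₚ (a *ℤ b) p
scaleₚ-assoc a b p = coeffwise λ i → trans (coeff-scaleₚ a (scaleₚ b p) i)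
  (trans (cong (a *ℤ_) (coeff-scaleₚ b p i)) (trans (sym (ℤ.*-assoc a b (coeff p i))) (sym (coeff-scaleₚ (a *ℤ b) p i))))

scaleₚ-zero : ∀ p → scaleₚ 0ℤ p ≋ []
scaleₚ-zero p = coeffwise λ i → coeff-scaleₚ 0ℤ p i

scaleₚ-identity : ∀ p → scaleₚ 1ℤ p ≋ p
scaleₚ-identity p = coeffwise λ i → trans (coeff-scaleₚ 1ℤ p i) (ℤ.*-identityˡ (coeff p i))

scaleₚ-shift : ∀ a p → scaleₚ a (0ℤ ∷ p) ≋ 0ℤ ∷ scaleₚ a p
scaleₚ-shift a p = ∷-cong (ℤ.*-zeroʳ a) ≋-refl

*ₚ-congʳ : ∀ p {q q′} → q ≋ q′ → p *ₚ q ≋ p *ₚ q′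
*ₚ-congʳ []      e = ≋-refl
*ₚ-congʳ (a ∷ p) e = +ₚ-cong (scaleₚ-cong a e) (∷-cong refl (*ₚ-congʳ p e))

*ₚ-zeroʳ : ∀ p → p *ₚ [] ≋ []
*ₚ-zeroʳ []      = ≋-refl
*ₚ-zeroʳ (a ∷ p) = ≋-trans (∷-cong refl (*ₚ-zeroʳ p)) [0]≋[]

*ₚ-∷ʳ : ∀ p a q → p *ₚ (a ∷ q) ≋ scaleₚ a p +ₚ (0ℤ ∷ p *ₚ q)
*ₚ-∷ʳ []      a q = ≋-sym [0]≋[]
*ₚ-∷ʳ (b ∷ p) a q = ∷-cong (cong (_+ℤ 0ℤ) (ℤ.*-comm b a)) (begin
  scaleₚ b q +ₚ (p *ₚ (a ∷ q))                    ≈⟨ +ₚ-cong ≋-refl (*ₚ-∷ʳ p a q) ⟩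
  scaleₚ b q +ₚ (scaleₚ a p +ₚ (0ℤ ∷ p *ₚ q))     ≈⟨ x∙yz≈y∙xz (scaleₚ b q) (scaleₚ a p) (0ℤ ∷ p *ₚ q) ⟩
  scaleₚ a p +ₚ (scaleₚ b q +ₚ (0ℤ ∷ p *ₚ q))     ∎)
  where open ≋-Reasoning

*ₚ-comm : ∀ p q → p *ₚ q ≋ q *ₚ p
*ₚ-comm []      q = ≋-sym (*ₚ-zeroʳ q)
*ₚ-comm (a ∷ p) q = ≋-trans (+ₚ-cong ≋-refl (∷-cong refl (*ₚ-comm p q))) (≋-sym (*ₚ-∷ʳ q a p))

*ₚ-cong : ∀ {p p′ q q′} → p ≋ p′ → q ≋ q′ → p *ₚ q ≋ p′ *ₚ q′
*ₚ-cong {p} {p′} {q} {q′} e f = begin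
  p *ₚ q   ≈⟨ *ₚ-congʳ p f ⟩
  p *ₚ q′  ≈⟨ *ₚ-comm p q′ ⟩
  q′ *ₚ p  ≈⟨ *ₚ-congʳ q′ e ⟩
  q′ *ₚ p′ ≈⟨ *ₚ-comm q′ p′ ⟩
  p′ *ₚ q′ ∎
  where open ≋-Reasoning

*ₚ-distribʳ : ∀ r p q → (p +ₚ q) *ₚ r ≋ (p *ₚ r) +ₚ (q *ₚ r)
*ₚ-distribʳ r []      q       = ≋-refl
*ₚ-distribʳ r (a ∷ p) []      = ≋-sym (+ₚ-identityʳ ((a ∷ p) *ₚ r))
*ₚ-distribʳ r (a ∷ p) (b ∷ q) = begin
  scaleₚ (a +ℤ b) r +ₚ (0ℤ ∷ (p +ₚ q) *ₚ r)
    ≈⟨ +ₚ-cong (scaleₚ-distribʳ a b r) (∷-cong refl (*ₚ-distribʳ r p q)) ⟩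
  (scaleₚ a r +ₚ scaleₚ b r) +ₚ ((0ℤ ∷ p *ₚ r) +ₚ (0ℤ ∷ q *ₚ r))
    ≈⟨ interchange (scaleₚ a r) (scaleₚ b r) (0ℤ ∷ p *ₚ r) (0ℤ ∷ q *ₚ r) ⟩
  (scaleₚ a r +ₚ (0ℤ ∷ p *ₚ r)) +ₚ (scaleₚ b r +ₚ (0ℤ ∷ q *ₚ r)) ∎
  where open ≋-Reasoning

scaleₚ-*ₚ : ∀ a p q → scaleₚ a p *ₚ q ≋ scaleₚ a (p *ₚ q)
scaleₚ-*ₚ a []      q = ≋-refl
scaleₚ-*ₚ a (b ∷ p) q = begin
  scaleₚ (a *ℤ b) q +ₚ (0ℤ ∷ scaleₚ a p *ₚ q)
    ≈⟨ +ₚ-cong (≋-sym (scaleₚ-assoc a b q)) (∷-cong refl (scaleₚ-*ₚ a p q)) ⟩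
  scaleₚ a (scaleₚ b q) +ₚ (0ℤ ∷ scaleₚ a (p *ₚ q))
    ≈⟨ +ₚ-cong ≋-refl (≋-sym (scaleₚ-shift a (p *ₚ q))) ⟩
  scaleₚ a (scaleₚ b q) +ₚ scaleₚ a (0ℤ ∷ p *ₚ q)
    ≈⟨ ≋-sym (scaleₚ-distribˡ a (scaleₚ b q) (0ℤ ∷ p *ₚ q)) ⟩
  scaleₚ a (scaleₚ b q +ₚ (0ℤ ∷ p *ₚ q)) ∎
  where open ≋-Reasoning

shift-*ₚ : ∀ p q → (0ℤ ∷ p) *ₚ q ≋ 0ℤ ∷ p *ₚ q
shift-*ₚ p q = +ₚ-cong (scaleₚ-zero q) (≋-refl {0ℤ ∷ p *ₚ q})

*ₚ-assoc : ∀ p q r → (p *ₚ q) *ₚ r ≋ p *ₚ (q *ₚ r)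
*ₚ-assoc []      q r = ≋-refl
*ₚ-assoc (a ∷ p) q r = begin
  (scaleₚ a q +ₚ (0ℤ ∷ p *ₚ q)) *ₚ r         ≈⟨ *ₚ-distribʳ r (scaleₚ a q) (0ℤ ∷ p *ₚ q) ⟩
  (scaleₚ a q *ₚ r) +ₚ ((0ℤ ∷ p *ₚ q) *ₚ r)    ≈⟨ +ₚ-cong (scaleₚ-*ₚ a q r) (shift-*ₚ (p *ₚ q) r) ⟩
  scaleₚ a (q *ₚ r) +ₚ (0ℤ ∷ (p *ₚ q) *ₚ r) ≈⟨ +ₚ-cong ≋-refl (∷-cong refl (*ₚ-assoc p q r)) ⟩
  scaleₚ a (q *ₚ r) +ₚ (0ℤ ∷ p *ₚ (q *ₚ r)) ∎
  where open ≋-Reasoning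

*ₚ-identityˡ : ∀ p → constₚ 1ℤ *ₚ p ≋ p
*ₚ-identityˡ p = ≋-trans (+ₚ-cong (scaleₚ-identity p) [0]≋[]) (+ₚ-identityʳ p)

Poly-commutativeSemiring : CommutativeSemiring 0ℓ 0ℓ
Poly-commutativeSemiring = record
  { _≈_ = _≋_
  ; _+_ = _+ₚ_
  ; _*_ = _*ₚ_
  ; 0#  = []
  ; 1#  = constₚ 1ℤ
  ; isCommutativeSemiring = isCommutativeSemiringˡ record
    { +-isCommutativeMonoid = CommutativeMonoid.isCommutativeMonoid +ₚ-commutativeMonoid
    ; *-isCommutativeMonoid = isCommutativeMonoidˡ record
      { isSemigroup = record
        { isMagma = record { isEquivalence = ≋-isEquivalence ; ∙-cong = *ₚ-cong }
        ; assoc   = *ₚ-assoc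
        }
      ; identityˡ = *ₚ-identityˡ
      ; comm      = *ₚ-comm
      }
    ; distribʳ = *ₚ-distribʳ
    ; zeroˡ    = λ _ → ≋-refl
    }
  }

Poly-almostCommutativeRing : AlmostCommutativeRing 0ℓ 0ℓ
Poly-almostCommutativeRing = fromCommutativeSemiring Poly-commutativeSemiring (λ _ → nothing)

open CommutativeSemiring Poly-commutativeSemiring using () renaming (*-identityʳ to *ₚ-identityʳ)

-- Evaluation at z = 1

nonZeroₚ-resp-≋ : ∀ {p q} → p ≋ q → NonZeroₚ q → NonZeroₚ p
nonZeroₚ-resp-≋ e (i , qᵢ≢0) = i , λ pᵢ≡0 → qᵢ≢0 (trans (sym (coeff-≡ e i)) pᵢ≡0)

eval₁ : Poly → ℤ
eval₁ []      = 0ℤ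
eval₁ (a ∷ p) = a +ℤ eval₁ p

eval₁-+ₚ : ∀ p q → eval₁ (p +ₚ q) ≡ eval₁ p +ℤ eval₁ q
eval₁-+ₚ []      q       = sym (ℤ.+-identityˡ (eval₁ q))
eval₁-+ₚ (a ∷ p) []      = sym (ℤ.+-identityʳ (a +ℤ eval₁ p))
eval₁-+ₚ (a ∷ p) (b ∷ q) =
  trans (cong ((a +ℤ b) +ℤ_) (eval₁-+ₚ p q)) (+ℤ-interchange a b (eval₁ p) (eval₁ q))
  where
  +ℤ-interchange : ∀ w x y z → (w +ℤ x) +ℤ (y +ℤ z) ≡ (w +ℤ y) +ℤ (x +ℤ z)
  +ℤ-interchange = ℤ-Solver.solve-∀

eval₁-scaleₚ : ∀ c p → eval₁ (scaleₚ c p) ≡ c *ℤ eval₁ p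
eval₁-scaleₚ c []      = sym (ℤ.*-zeroʳ c)
eval₁-scaleₚ c (a ∷ p) = trans (cong ((c *ℤ a) +ℤ_) (eval₁-scaleₚ c p)) (sym (ℤ.*-distribˡ-+ c a (eval₁ p)))

eval₁-*ₚ : ∀ p q → eval₁ (p *ₚ q) ≡ eval₁ p *ℤ eval₁ q
eval₁-*ₚ []      q = refl
eval₁-*ₚ (a ∷ p) q = begin
  eval₁ (scaleₚ a q +ₚ (0ℤ ∷ p *ₚ q))           ≡⟨ eval₁-+ₚ (scaleₚ a q) (0ℤ ∷ p *ₚ q) ⟩
  eval₁ (scaleₚ a q) +ℤ (0ℤ +ℤ eval₁ (p *ₚ q)) ≡⟨ cong₂ (λ x y → x +ℤ (0ℤ +ℤ y)) (eval₁-scaleₚ a q) (eval₁-*ₚ p q) ⟩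
  a *ℤ eval₁ q +ℤ (0ℤ +ℤ eval₁ p *ℤ eval₁ q)   ≡⟨ distrib a (eval₁ p) (eval₁ q) ⟩
  (a +ℤ eval₁ p) *ℤ eval₁ q                    ∎
  where
  open ≡-Reasoning
  distrib : ∀ x y z → x *ℤ z +ℤ (0ℤ +ℤ y *ℤ z) ≡ (x +ℤ y) *ℤ z
  distrib = ℤ-Solver.solve-∀

eval₁-*ₚ-≢0 : ∀ p q → eval₁ p ≢ 0ℤ → eval₁ q ≢ 0ℤ → eval₁ (p *ₚ q) ≢ 0ℤ
eval₁-*ₚ-≢0 p q p≢0 q≢0 pq≡0 =
  [ p≢0 , q≢0 ]′ (ℤ.i*j≡0⇒i≡0∨j≡0 (eval₁ p) (trans (sym (eval₁-*ₚ p q)) pq≡0))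

eval₁≢0⇒nonZeroₚ : ∀ p → eval₁ p ≢ 0ℤ → NonZeroₚ p
eval₁≢0⇒nonZeroₚ []      p≢0 = ⊥-elim (p≢0 refl)
eval₁≢0⇒nonZeroₚ (a ∷ p) p≢0 with a ℤ.≟ 0ℤ
... | no  a≢0  = 0 , a≢0
... | yes refl with eval₁≢0⇒nonZeroₚ p (λ e → p≢0 (trans (ℤ.+-identityˡ (eval₁ p)) e))
...   | i , pᵢ≢0 = suc i , pᵢ≢0

-- Representatives of the vertices

infix 8 _·z+_
_·z+_ : ℕ → ℕ → Poly
a ·z+ b = + b ∷ + a ∷ []

·z+-+ₚ : ∀ a b c d → (a ·z+ b) +ₚ (c ·z+ d) ≋ (a + c) ·z+ (b + d)
·z+-+ₚ a b c d = ∷-cong (sym (ℤ.pos-+ b d)) (∷-cong (sym (ℤ.pos-+ a c)) ≋-refl)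

constₚ-*ₚ-·z+ : ∀ m a b → constₚ (+ m) *ₚ (a ·z+ b) ≋ (m * a) ·z+ (m * b)
constₚ-*ₚ-·z+ m a b =
  ∷-cong (trans (ℤ.+-identityʳ (+ m *ℤ + b)) (sym (ℤ.pos-* m b))) (∷-cong (sym (ℤ.pos-* m a)) ≋-refl)

eval₁-·z+ : ∀ a b → eval₁ (a ·z+ b) ≡ + (b + a)
eval₁-·z+ a b = trans (cong (λ x → + b +ℤ x) (ℤ.+-identityʳ (+ a))) (sym (ℤ.pos-+ b a))

eval₁-·z+-≢0 : ∀ a {b} → b ≢ 0 → eval₁ (a ·z+ b) ≢ 0ℤ
eval₁-·z+-≢0 a {b} b≢0 e = b≢0 (ℕ.m+n≡0⇒m≡0 b (ℤ.+-injective (trans (sym (eval₁-·z+ a b)) e)))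

-- Equality of the representing fractions, finer than equality _≈_ in ℚ(z).
infix 4 _≅_
record _≅_ (f g : RatFun) : Set where
  constructor componentwise
  field
    num-≋ : num f ≋ num g
    den-≋ : den f ≋ den g
open _≅_

≅-refl : ∀ {f} → f ≅ f
≅-refl = componentwise ≋-refl ≋-refl

≅-trans : ∀ {f g h} → f ≅ g → g ≅ h → f ≅ h
≅-trans (componentwise n₁ d₁) (componentwise n₂ d₂) = componentwise (≋-trans n₁ n₂) (≋-trans d₁ d₂)

⊕-cong : ∀ {f f′ g g′} → f ≅ f′ → g ≅ g′ → f ⊕ g ≅ f′ ⊕ g′
⊕-cong (componentwise n₁ d₁) (componentwise n₂ d₂) =
  componentwise (+ₚ-cong (*ₚ-cong n₁ d₂) (*ₚ-cong n₂ d₁)) (*ₚ-cong d₁ d₂)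

⊗-cong : ∀ {f f′ g g′} → f ≅ f′ → g ≅ g′ → f ⊗ g ≅ f′ ⊗ g′
⊗-cong (componentwise n₁ d₁) (componentwise n₂ d₂) = componentwise (*ₚ-cong n₁ n₂) (*ₚ-cong d₁ d₂)

⊘-cong : ∀ {f f′ g g′} → f ≅ f′ → g ≅ g′ → f ⊘ g ≅ f′ ⊘ g′
⊘-cong (componentwise n₁ d₁) (componentwise n₂ d₂) = componentwise (*ₚ-cong n₁ d₂) (*ₚ-cong d₁ n₂)

≈-resp-≅ : ∀ {f f′ g g′} → f ≅ f′ → g ≅ g′ → f′ ≈ g′ → f ≈ g
≈-resp-≅ (componentwise n₁ d₁) (componentwise n₂ d₂) f′≈g′ = coeff-≡ (≋-trans (*ₚ-cong n₁ d₂)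
  (≋-trans (coeffwise f′≈g′) (≋-sym (*ₚ-cong n₂ d₁))))

common-factor-≈ : ∀ k p q → ((k *ₚ p) // (k *ₚ q)) ≈ (p // q)
common-factor-≈ k p q = coeff-≡ (swap k p q)
  where
  swap : ∀ k p q → (k *ₚ p) *ₚ q ≋ p *ₚ (k *ₚ q)
  swap = solve-∀ Poly-almostCommutativeRing

möb-≅ : ∀ a b c d → möb a b c d ≅ (a ·z+ b) // (c ·z+ d)
möb-≅ a b c d = componentwise (≋-trans (unitsˡ (constₚ (+ a)) (constₚ (+ b)) Xₚ) (affine a b))
                              (≋-trans (unitsʳ (constₚ (+ c)) (constₚ (+ d)) Xₚ) (affine c d))
  where
  unitsˡ : ∀ A B X → (((A *ₚ X) *ₚ constₚ 1ℤ) +ₚ (B *ₚ (constₚ 1ℤ *ₚ constₚ 1ℤ)))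
                       *ₚ ((constₚ 1ℤ *ₚ constₚ 1ℤ) *ₚ constₚ 1ℤ) ≋ (A *ₚ X) +ₚ B
  unitsˡ = solve-∀ Poly-almostCommutativeRing
  unitsʳ : ∀ A B X → ((constₚ 1ℤ *ₚ constₚ 1ℤ) *ₚ constₚ 1ℤ)
                       *ₚ (((A *ₚ X) *ₚ constₚ 1ℤ) +ₚ (B *ₚ (constₚ 1ℤ *ₚ constₚ 1ℤ))) ≋ (A *ₚ X) +ₚ B
  unitsʳ = solve-∀ Poly-almostCommutativeRing
  affine : ∀ a b → (constₚ (+ a) *ₚ Xₚ) +ₚ constₚ (+ b) ≋ a ·z+ b
  affine a b = ∷-cong (trans (cong (_+ℤ + b) (trans (ℤ.+-identityʳ (+ a *ℤ 0ℤ)) (ℤ.*-zeroʳ (+ a))))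
                             (ℤ.+-identityˡ (+ b)))
                      (∷-cong (ℤ.*-identityʳ (+ a)) ≋-refl)

rightChild-≅ : ∀ k N D V →
  ((k *ₚ N) // (k *ₚ D)) ⊕ (V // constₚ 1ℤ) ≅ (k *ₚ (N +ₚ (V *ₚ D))) // (k *ₚ D)
rightChild-≅ k N D V = componentwise (sum-≋ k N D V) (*ₚ-identityʳ (k *ₚ D))
  where
  sum-≋ : ∀ k N D V → ((k *ₚ N) *ₚ constₚ 1ℤ) +ₚ (V *ₚ (k *ₚ D)) ≋ k *ₚ (N +ₚ (V *ₚ D))
  sum-≋ = solve-∀ Poly-almostCommutativeRing

leftChild-≅ : ∀ k N D U → let w = (k *ₚ N) // (k *ₚ D) in
  w ⊘ (((U // constₚ 1ℤ) ⊗ w) ⊕ ι 1ℤ) ≅ ((k *ₚ (k *ₚ D)) *ₚ N) // ((k *ₚ (k *ₚ D)) *ₚ ((U *ₚ N) +ₚ D))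
leftChild-≅ k N D U = componentwise (numerator k N D) (denominator k N D U)
  where
  numerator : ∀ k N D → (k *ₚ N) *ₚ ((constₚ 1ℤ *ₚ (k *ₚ D)) *ₚ constₚ 1ℤ) ≋ (k *ₚ (k *ₚ D)) *ₚ N
  numerator = solve-∀ Poly-almostCommutativeRing
  denominator : ∀ k N D U →
    (k *ₚ D) *ₚ (((U *ₚ (k *ₚ N)) *ₚ constₚ 1ℤ) +ₚ (constₚ 1ℤ *ₚ (constₚ 1ℤ *ₚ (k *ₚ D))))
      ≋ (k *ₚ (k *ₚ D)) *ₚ ((U *ₚ N) +ₚ D)
  denominator = solve-∀ Poly-almostCommutativeRing

Unimodular : ℕ → ℕ → ℕ → ℕ → Set
Unimodular a b c d = a * d ≡ b * c + 1

Unimodular-addToTop : ∀ v a b c d → Unimodular a b c d → Unimodular (a + v * c) (b + v * d) c d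
Unimodular-addToTop v a b c d det = begin
  (a + v * c) * d          ≡⟨ ℕ-Solver.solve (a ∷ v ∷ c ∷ d ∷ []) ⟩
  a * d + v * c * d        ≡⟨ cong (_+ v * c * d) det ⟩
  b * c + 1 + v * c * d    ≡⟨ ℕ-Solver.solve (b ∷ v ∷ c ∷ d ∷ []) ⟩
  (b + v * d) * c + 1      ∎
  where open ≡-Reasoning

Unimodular-addToBottom : ∀ u a b c d → Unimodular a b c d → Unimodular a b (u * a + c) (u * b + d)
Unimodular-addToBottom u a b c d det = begin
  a * (u * b + d)          ≡⟨ ℕ-Solver.solve (a ∷ u ∷ b ∷ d ∷ []) ⟩
  u * a * b + a * d        ≡⟨ cong (λ x → u * a * b + x) det ⟩
  u * a * b + (b * c + 1)  ≡⟨ ℕ-Solver.solve (u ∷ a ∷ b ∷ c ∷ []) ⟩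
  b * (u * a + c) + 1      ∎
  where open ≡-Reasoning

Unimodular⇒d≢0 : ∀ a b c d → Unimodular a b c d → d ≢ 0
Unimodular⇒d≢0 a b c d det refl = ℕ.0≢1+n (trans (sym (ℕ.*-zeroʳ a)) (trans det (ℕ.+-comm (b * c) 1)))

-- The common factor is never cancelled, which would need ℤ[z] to be an integral
-- domain; instead its value at z = 1 certifies that it is nonzero.
record MöbiusForm (w : RatFun) : Set where
  field
    a b c d        : ℕ
    unimodular     : Unimodular a b c d
    factor         : Poly
    eval₁-factor≢0 : eval₁ factor ≢ 0ℤ
    representative : w ≅ (factor *ₚ (a ·z+ b)) // (factor *ₚ (c ·z+ d))

  eval₁-den≢0 : eval₁ (factor *ₚ (c ·z+ d)) ≢ 0ℤ
  eval₁-den≢0 = eval₁-*ₚ-≢0 factor (c ·z+ d) eval₁-factor≢0 (eval₁-·z+-≢0 c (Unimodular⇒d≢0 a b c d unimodular))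

  den-nonZero : NonZeroₚ (den w)
  den-nonZero = nonZeroₚ-resp-≋ (den-≋ representative) (eval₁≢0⇒nonZeroₚ (factor *ₚ (c ·z+ d)) eval₁-den≢0)

  ≈-möb : w ≈ möb a b c d
  ≈-möb = ≈-resp-≅ representative (möb-≅ a b c d) (common-factor-≈ factor (a ·z+ b) (c ·z+ d))

root-form : MöbiusForm 𝕫
root-form = record
  { a = 1 ; b = 0 ; c = 0 ; d = 1
  ; unimodular     = refl
  ; factor         = constₚ 1ℤ
  ; eval₁-factor≢0 = λ ()
  ; representative = componentwise (≋-sym (*ₚ-identityˡ Xₚ))
                                   (≋-sym (≋-trans (*ₚ-identityˡ (0 ·z+ 1)) (∷-cong refl [0]≋[])))
  }

right-form : ∀ v {w} → MöbiusForm w → MöbiusForm (w ⊕ ι (+ v))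
right-form v F = record
  { a = a + v * c ; b = b + v * d ; c = c ; d = d
  ; unimodular     = Unimodular-addToTop v a b c d unimodular
  ; factor         = factor
  ; eval₁-factor≢0 = eval₁-factor≢0
  ; representative = ≅-trans (⊕-cong representative (≅-refl {ι (+ v)}))
                    (≅-trans (rightChild-≅ factor (a ·z+ b) (c ·z+ d) (constₚ (+ v)))
                             (componentwise (*ₚ-congʳ factor top-row) ≋-refl))
  }
  where
  open MöbiusForm F
  top-row : (a ·z+ b) +ₚ (constₚ (+ v) *ₚ (c ·z+ d)) ≋ (a + v * c) ·z+ (b + v * d)
  top-row = ≋-trans (+ₚ-cong (≋-refl {a ·z+ b}) (constₚ-*ₚ-·z+ v c d)) (·z+-+ₚ a b (v * c) (v * d))

left-form : ∀ u {w} → MöbiusForm w → MöbiusForm (w ⊘ ((ι (+ u) ⊗ w) ⊕ ι 1ℤ))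
left-form u F = record
  { a = a ; b = b ; c = u * a + c ; d = u * b + d
  ; unimodular     = Unimodular-addToBottom u a b c d unimodular
  ; factor         = factor′
  ; eval₁-factor≢0 = eval₁-*ₚ-≢0 factor (factor *ₚ (c ·z+ d)) eval₁-factor≢0 eval₁-den≢0
  ; representative = ≅-trans (⊘-cong representative
                               (⊕-cong (⊗-cong (≅-refl {ι (+ u)}) representative) (≅-refl {ι 1ℤ})))
                    (≅-trans (leftChild-≅ factor (a ·z+ b) (c ·z+ d) (constₚ (+ u)))
                             (componentwise ≋-refl (*ₚ-congʳ factor′ bottom-row)))
  }
  where
  open MöbiusForm F
  factor′ : Poly
  factor′ = factor *ₚ (factor *ₚ (c ·z+ d))
  bottom-row : (constₚ (+ u) *ₚ (a ·z+ b)) +ₚ (c ·z+ d) ≋ (u * a + c) ·z+ (u * b + d)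
  bottom-row = ≋-trans (+ₚ-cong (constₚ-*ₚ-·z+ u a b) (≋-refl {c ·z+ d})) (·z+-+ₚ (u * a) (u * b) c d)

vertex-form : ∀ {u v w} → IsVertex u v w → MöbiusForm w
vertex-form         root      = root-form
vertex-form {u}     (left x)  = left-form u (vertex-form x)
vertex-form {v = v} (right x) = right-form v (vertex-form x)

lemma4p1 : (u v : ℕ) → 1 ≤ u → 1 ≤ v → (w : RatFun) → IsVertex u v w →
    NonZeroₚ (den w) ×
    Σ ℕ (λ a → Σ ℕ (λ b → Σ ℕ (λ c → Σ ℕ (λ d →
      (a * d ≡ b * c + 1) × (w ≈ möb a b c d)))))
lemma4p1 u v _ _ w x = den-nonZero , a , b , c , d , unimodular , ≈-möb
  where open MöbiusForm (vertex-form x)
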